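{- For any $p\in[0,1]$ and any $n\ge1$, in a row of $n$ seats with a single entrance filled by $p$-courteous theatregoers choosing seats according to the right-biased geometric distribution (model described in the context), the expected number of occupied seats when the process ends is at least $\frac{n+1}{2}$. Moreover, this bound is attained (with equality) for $p=0$.
   Context: Row model: a row of $n$ seats with a single entrance at one end. Theatregoers arrive one at a time; each is, independently, courteous with probability $p$ and selfish with probability $1-p$, and this status never changes. A seated selfish theatregoer never gets up, so no later theatregoer can walk past her seat; a seated courteous theatregoer never blocks. An empty seat is accessible if it can be reached from the entrance without passing a seat occupied by a selfish theatregoer. When there are $m\ge1$ accessible empty seats, labelled $1,\dots,m$ in increasing order of distance from the entrance, the arriving theatregoer sits in the $j$-th one with probability $2^{ -(m+1-j)}$ for $j=2,\dots,m$ and with probability $2^{ -(m-1)}$ for $j=1$ (right-biased geometric distribution). The process ends when no accessible empty seat remains.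
   Formalization: The courtesy probability p ranges over the rationals in $[0,1]$. -}

module Defs where

open import Data.Nat as ℕ using (ℕ; zero; suc)
open import Data.Integer using (+_)
open import Data.List using (List; []; _∷_; replicate)
open import Data.Rational using (ℚ; 0ℚ; 1ℚ; ½; _+_; _*_; _-_; _/_)

-- State of a seat in the row. The row is a list ordered by increasing
-- distance from the (single) entrance.
data Seat : Set where
  empty     : Seat
  courteous : Seat   -- occupied by a courteous theatregoer (never blocks)
  selfish   : Seat   -- occupied by a selfish theatregoer (blocks all seats behind her)

accessibleEmpty : List Seat → ℕ
accessibleEmpty []               = zero
accessibleEmpty (empty ∷ s)      = suc (accessibleEmpty s)
accessibleEmpty (courteous ∷ s)  = accessibleEmpty s
accessibleEmpty (selfish ∷ s)    = zero

occupied : List Seat → ℕ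
occupied []              = zero
occupied (empty ∷ s)     = occupied s
occupied (courteous ∷ s) = suc (occupied s)
occupied (selfish ∷ s)   = suc (occupied s)

-- seat an arriving theatregoer of the given type in the i-th (0-based,
-- counted from the entrance) accessible empty seat
place : ℕ → Seat → List Seat → List Seat
place i       t []              = []
place zero    t (empty ∷ s)     = t ∷ s
place (suc i) t (empty ∷ s)     = empty ∷ place i t s
place i       t (courteous ∷ s) = courteous ∷ place i t s
place i       t (selfish ∷ s)   = selfish ∷ s

halfPow : ℕ → ℚ
halfPow zero    = 1ℚ
halfPow (suc k) = ½ * halfPow k

-- right-biased geometric distribution on m accessible empty seats labelled
-- j = 1..m; argument is j (1-based): P(j) = 2^{-(m+1-j)} for j ≥ 2, P(1) = 2^{-(m-1)}
geomWeight : (m j : ℕ) → ℚ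
geomWeight m (suc zero) = halfPow (m ℕ.∸ 1)
geomWeight m j          = halfPow ((suc m) ℕ.∸ j)

sumFrom1 : ℕ → (ℕ → ℚ) → ℚ
sumFrom1 zero    f = 0ℚ
sumFrom1 (suc k) f = sumFrom1 k f + f (suc k)

-- Expected number of occupied seats at the end of the process, started
-- from row state s, where each newcomer is courteous with probability p.
-- The fuel argument bounds the number of remaining arrivals; since every
-- arrival fills one empty seat, fuel ≥ (number of empty seats) suffices.
expectedFinal : ℕ → ℚ → List Seat → ℚ
expectedFinal zero       p s = + occupied s / 1
expectedFinal (suc fuel) p s with accessibleEmpty s
... | zero = + occupied s / 1
... | suc m' = sumFrom1 (suc m') λ j →
        geomWeight (suc m') j *
          (p * expectedFinal fuel p (place (j ℕ.∸ 1) courteous s)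
           + (1ℚ - p) * expectedFinal fuel p (place (j ℕ.∸ 1) selfish s))

expectedOccupied : ℚ → ℕ → ℚ
expectedOccupied p n = expectedFinal n p (replicate n empty)

{-# OPTIONS --safe #-}
-- selfishValue s, the number of occupied seats plus selfishFill a (a the number of accessible
-- empty seats, selfishFill 0 = 0 and selfishFill a = (a + 1)/2 otherwise), is the expected
-- final occupancy from s when every later arrival is selfish: a selfish arrival in the i-th
-- accessible seat leaves i accessible seats, and selfishFill a = 1 + E[selfishFill i] under
-- the right-biased geometric choice of i. A courteous arrival leaves a − 1 seats instead, so
-- each arrival raises the expectation of selfishValue by p · courtesyGain (a − 1), which is
-- nonnegative. Hence selfishValue bounds the expected final occupancy from below, with
-- equality when p = 0, and it is (n + 1)/2 on the empty row.
module Submission where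

open import Defs
open import Data.Nat using (ℕ; suc; _≥_)
open import Data.Integer using (+_)
open import Data.Rational using (ℚ; 0ℚ; 1ℚ; _≤_; _/_)
open import Data.Product using (_×_)
open import Relation.Binary.PropositionalEquality using (_≡_)

open import Data.Nat as ℕ using (zero; _∸_; z≤n; s≤s)
import Data.Nat.Properties as ℕ
import Data.Integer as ℤ
open import Data.List using (List; _∷_; replicate)
open import Data.Rational using (_+_; _*_; _-_; ½; NonNegative; nonNegative; fromℚᵘ)
open import Data.Rational.Properties
open import Data.Rational.Unnormalised using (mkℚᵘ)
import Data.Rational.Unnormalised as ℚᵘ
import Data.Rational.Unnormalised.Properties as ℚᵘ
open import Data.Product using (_,_)
open import Relation.Binary.PropositionalEquality
open import Relation.Nullary using (contradiction)
import Data.Integer.Solver as ℤ-Solver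
import Data.Rational.Solver as ℚ-Solver

fromℚᵘ-homo-+ : ∀ p q → fromℚᵘ (p ℚᵘ.+ q) ≡ fromℚᵘ p + fromℚᵘ q
fromℚᵘ-homo-+ p q = toℚᵘ-injective (ℚᵘ.≃-trans (toℚᵘ-fromℚᵘ (p ℚᵘ.+ q))
  (ℚᵘ.≃-sym (ℚᵘ.≃-trans (toℚᵘ-homo-+ (fromℚᵘ p) (fromℚᵘ q))
                        (ℚᵘ.+-cong (toℚᵘ-fromℚᵘ p) (toℚᵘ-fromℚᵘ q)))))

/-suc-numerator : ∀ m d → + suc m / suc d ≡ + m / suc d + + 1 / suc d
/-suc-numerator m d = begin
  fromℚᵘ (mkℚᵘ (+ suc m) d)
    ≡⟨ fromℚᵘ-cong {mkℚᵘ (+ suc m) d} {sum} (ℚᵘ.*≡* cross-multiplied) ⟩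
  fromℚᵘ sum                 ≡⟨ fromℚᵘ-homo-+ (mkℚᵘ (+ m) d) (mkℚᵘ (+ 1) d) ⟩
  + m / suc d + + 1 / suc d  ∎
  where
  open ≡-Reasoning
  open ℤ-Solver.+-*-Solver
  sum = mkℚᵘ (+ m) d ℚᵘ.+ mkℚᵘ (+ 1) d
  cross-multiplied : + suc m ℤ.* (+ suc d ℤ.* + suc d)
                   ≡ (+ m ℤ.* + suc d ℤ.+ + 1 ℤ.* + suc d) ℤ.* + suc d
  cross-multiplied =
    solve 2 (λ m d → (con (+ 1) :+ m) :* (d :* d) := (m :* d :+ con (+ 1) :* d) :* d)
            refl (+ m) (+ suc d)

fromℕ : ℕ → ℚ
fromℕ n = + n / 1

fromℕ-suc : ∀ n → fromℕ (suc n) ≡ fromℕ n + 1ℚ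
fromℕ-suc n = /-suc-numerator n 0

sumFrom1-cong : ∀ k {f g : ℕ → ℚ} → (∀ i → i ℕ.< k → f (suc i) ≡ g (suc i)) →
                sumFrom1 k f ≡ sumFrom1 k g
sumFrom1-cong zero    f≡g = refl
sumFrom1-cong (suc k) f≡g =
  cong₂ _+_ (sumFrom1-cong k (λ i i<k → f≡g i (ℕ.m<n⇒m<1+n i<k))) (f≡g k ℕ.≤-refl)

sumFrom1-*ˡ : ∀ k c (f : ℕ → ℚ) → sumFrom1 k (λ j → c * f j) ≡ c * sumFrom1 k f
sumFrom1-*ˡ zero    c f = sym (*-zeroʳ c)
sumFrom1-*ˡ (suc k) c f = begin
  sumFrom1 k (λ j → c * f j) + c * f (suc k) ≡⟨ cong (_+ c * f (suc k)) (sumFrom1-*ˡ k c f) ⟩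
  c * sumFrom1 k f + c * f (suc k)           ≡⟨ *-distribˡ-+ c (sumFrom1 k f) (f (suc k)) ⟨
  c * (sumFrom1 k f + f (suc k))             ∎
  where open ≡-Reasoning

geomMean : ℕ → (ℕ → ℚ) → ℚ
geomMean k f = sumFrom1 k (λ j → geomWeight k j * f j)

geomWeight-suc : ∀ k i → i ℕ.< suc k →
                 geomWeight (suc (suc k)) (suc i) ≡ ½ * geomWeight (suc k) (suc i)
geomWeight-suc k zero    _         = refl
geomWeight-suc k (suc i) (s≤s i<k) = cong halfPow (ℕ.+-∸-assoc 1 (ℕ.<⇒≤ i<k))

geomMean-one : ∀ f → geomMean 1 f ≡ f 1
geomMean-one f = trans (+-identityˡ (1ℚ * f 1)) (*-identityˡ (f 1))

geomMean-suc : ∀ k f →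
               geomMean (suc (suc k)) f ≡ ½ * geomMean (suc k) f + ½ * f (suc (suc k))
geomMean-suc k f = cong₂ _+_ first-seats last-seat
  where
  first-seats : sumFrom1 (suc k) (λ j → geomWeight (suc (suc k)) j * f j)
              ≡ ½ * geomMean (suc k) f
  first-seats = trans
    (sumFrom1-cong (suc k) λ i i<k → trans (cong (_* f (suc i)) (geomWeight-suc k i i<k))
                                            (*-assoc ½ (geomWeight (suc k) (suc i)) (f (suc i))))
    (sumFrom1-*ˡ (suc k) ½ (λ j → geomWeight (suc k) j * f j))
  last-seat : geomWeight (suc (suc k)) (suc (suc k)) * f (suc (suc k)) ≡ ½ * f (suc (suc k))
  last-seat = cong (λ e → halfPow e * f (suc (suc k))) (ℕ.m+n∸n≡m 1 k)

geomMean-mono : ∀ k {f g : ℕ → ℚ} → (∀ i → i ℕ.< k → f (suc i) ≤ g (suc i)) →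
                geomMean k f ≤ geomMean k g
geomMean-mono zero                   f≤g = ≤-refl
geomMean-mono (suc zero) {f} {g}     f≤g = begin
  geomMean 1 f ≡⟨ geomMean-one f ⟩
  f 1          ≤⟨ f≤g 0 (s≤s z≤n) ⟩
  g 1          ≡⟨ geomMean-one g ⟨
  geomMean 1 g ∎
  where open ≤-Reasoning
geomMean-mono (suc (suc k)) {f} {g} f≤g = begin
  geomMean (suc (suc k)) f                     ≡⟨ geomMean-suc k f ⟩
  ½ * geomMean (suc k) f + ½ * f (suc (suc k))
    ≤⟨ +-mono-≤ (*-monoˡ-≤-nonNeg ½ (geomMean-mono (suc k) λ i i<k → f≤g i (ℕ.m<n⇒m<1+n i<k)))
                (*-monoˡ-≤-nonNeg ½ (f≤g (suc k) ℕ.≤-refl)) ⟩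
  ½ * geomMean (suc k) g + ½ * g (suc (suc k)) ≡⟨ geomMean-suc k g ⟨
  geomMean (suc (suc k)) g                     ∎
  where open ≤-Reasoning

geomMean-cong : ∀ k {f g : ℕ → ℚ} → (∀ i → i ℕ.< k → f (suc i) ≡ g (suc i)) →
                geomMean k f ≡ geomMean k g
geomMean-cong k f≡g = ≤-antisym (geomMean-mono k λ i i<k → ≤-reflexive (f≡g i i<k))
                                (geomMean-mono k λ i i<k → ≤-reflexive (sym (f≡g i i<k)))

geomMean-affine : ∀ k a b f →
                  geomMean (suc k) (λ j → a + b * f j) ≡ a + b * geomMean (suc k) f
geomMean-affine zero    a b f =
  trans (geomMean-one (λ j → a + b * f j)) (cong (λ x → a + b * x) (sym (geomMean-one f)))
geomMean-affine (suc k) a b f = begin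
  geomMean (suc (suc k)) (λ j → a + b * f j)
    ≡⟨ geomMean-suc k (λ j → a + b * f j) ⟩
  ½ * geomMean (suc k) (λ j → a + b * f j) + ½ * (a + b * f (suc (suc k)))
    ≡⟨ cong (λ x → ½ * x + ½ * (a + b * f (suc (suc k)))) (geomMean-affine k a b f) ⟩
  ½ * (a + b * geomMean (suc k) f) + ½ * (a + b * f (suc (suc k)))
    ≡⟨ solve 4 (λ a b m x → con ½ :* (a :+ b :* m) :+ con ½ :* (a :+ b :* x)
                          := a :+ b :* (con ½ :* m :+ con ½ :* x))
             refl a b (geomMean (suc k) f) (f (suc (suc k))) ⟩
  a + b * (½ * geomMean (suc k) f + ½ * f (suc (suc k)))
    ≡⟨ cong (λ x → a + b * x) (geomMean-suc k f) ⟨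
  a + b * geomMean (suc (suc k)) f ∎
  where
  open ≡-Reasoning
  open ℚ-Solver.+-*-Solver

selfishFill : ℕ → ℚ
selfishFill zero    = 0ℚ
selfishFill (suc m) = + suc (suc m) / 2

selfishFill-suc : ∀ m → selfishFill (suc (suc m)) ≡ selfishFill (suc m) + ½
selfishFill-suc m = /-suc-numerator (suc (suc m)) 1

selfishFill-mean : ∀ k →
                   geomMean (suc k) (λ j → selfishFill (j ∸ 1)) ≡ selfishFill (suc k) - 1ℚ
selfishFill-mean zero    = refl
selfishFill-mean (suc k) = begin
  geomMean (suc (suc k)) (λ j → selfishFill (j ∸ 1))
    ≡⟨ geomMean-suc k (λ j → selfishFill (j ∸ 1)) ⟩
  ½ * geomMean (suc k) (λ j → selfishFill (j ∸ 1)) + ½ * x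
    ≡⟨ cong (λ y → ½ * y + ½ * x) (selfishFill-mean k) ⟩
  ½ * (x - 1ℚ) + ½ * x
    ≡⟨ solve 1 (λ x → con ½ :* (x :- con 1ℚ) :+ con ½ :* x := (x :+ con ½) :- con 1ℚ) refl x ⟩
  (x + ½) - 1ℚ
    ≡⟨ cong (_- 1ℚ) (selfishFill-suc k) ⟨
  selfishFill (suc (suc k)) - 1ℚ ∎
  where
  open ≡-Reasoning
  open ℚ-Solver.+-*-Solver
  x = selfishFill (suc k)

courtesyGain : ℕ → ℚ
courtesyGain m = 1ℚ + selfishFill m - selfishFill (suc m)

courtesyGain-nonNeg : ∀ m → 0ℚ ≤ courtesyGain m
courtesyGain-nonNeg zero    = ≤-refl
courtesyGain-nonNeg (suc m) = begin
  0ℚ                    ≤⟨ nonNegative⁻¹ ½ ⟩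
  ½                     ≡⟨ solve 1 (λ x → con ½ := con 1ℚ :+ x :- (x :+ con ½)) refl x ⟩
  1ℚ + x - (x + ½)      ≡⟨ cong (λ y → 1ℚ + x - y) (selfishFill-suc m) ⟨
  courtesyGain (suc m)  ∎
  where
  open ≤-Reasoning
  open ℚ-Solver.+-*-Solver
  x = selfishFill (suc m)

occupied-place : ∀ {t} → t ≢ empty → ∀ i s → i ℕ.< accessibleEmpty s →
                 occupied (place i t s) ≡ suc (occupied s)
occupied-place {empty}     t≢e zero    (empty ∷ s)     _         = contradiction refl t≢e
occupied-place {courteous} t≢e zero    (empty ∷ s)     _         = refl
occupied-place {selfish}   t≢e zero    (empty ∷ s)     _         = refl
occupied-place             t≢e (suc i) (empty ∷ s)     (s≤s i<a) = occupied-place t≢e i s i<a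
occupied-place             t≢e zero    (courteous ∷ s) i<a       =
  cong suc (occupied-place t≢e zero s i<a)
occupied-place             t≢e (suc i) (courteous ∷ s) i<a       =
  cong suc (occupied-place t≢e (suc i) s i<a)

accessibleEmpty-place-courteous : ∀ i s → i ℕ.< accessibleEmpty s →
                                  suc (accessibleEmpty (place i courteous s)) ≡ accessibleEmpty s
accessibleEmpty-place-courteous zero    (empty ∷ s)     _         = refl
accessibleEmpty-place-courteous (suc i) (empty ∷ s)     (s≤s i<a) =
  cong suc (accessibleEmpty-place-courteous i s i<a)
accessibleEmpty-place-courteous zero    (courteous ∷ s) i<a       =
  accessibleEmpty-place-courteous zero s i<a
accessibleEmpty-place-courteous (suc i) (courteous ∷ s) i<a       =
  accessibleEmpty-place-courteous (suc i) s i<a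

accessibleEmpty-place-selfish : ∀ i s → i ℕ.< accessibleEmpty s →
                                accessibleEmpty (place i selfish s) ≡ i
accessibleEmpty-place-selfish zero    (empty ∷ s)     _         = refl
accessibleEmpty-place-selfish (suc i) (empty ∷ s)     (s≤s i<a) =
  cong suc (accessibleEmpty-place-selfish i s i<a)
accessibleEmpty-place-selfish zero    (courteous ∷ s) i<a       =
  accessibleEmpty-place-selfish zero s i<a
accessibleEmpty-place-selfish (suc i) (courteous ∷ s) i<a       =
  accessibleEmpty-place-selfish (suc i) s i<a

accessibleEmpty-place-≤ : ∀ {t} → t ≢ empty → ∀ i s {m} →
                          accessibleEmpty s ≡ suc m → i ℕ.< suc m →
                          accessibleEmpty (place i t s) ℕ.≤ m
accessibleEmpty-place-≤ {empty}     t≢e i s eq i<k = contradiction refl t≢e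
accessibleEmpty-place-≤ {courteous} t≢e i s eq i<k = ℕ.≤-reflexive (ℕ.suc-injective
  (trans (accessibleEmpty-place-courteous i s (subst (i ℕ.<_) (sym eq) i<k)) eq))
accessibleEmpty-place-≤ {selfish}   t≢e i s eq i<k
  rewrite accessibleEmpty-place-selfish i s (subst (i ℕ.<_) (sym eq) i<k) = ℕ.≤-pred i<k

-- Once accessibleEmpty s is known to be suc m, expectedFinal (suc fuel) p s reduces to
-- arrivalMean p (expectedFinal fuel p) s (suc m); the seat labelled j is index j ∸ 1 of place.
arrivalValue : ℚ → (List Seat → ℚ) → List Seat → ℕ → ℚ
arrivalValue p f s i = p * f (place i courteous s) + (1ℚ - p) * f (place i selfish s)

arrivalMean : ℚ → (List Seat → ℚ) → List Seat → ℕ → ℚ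
arrivalMean p f s k = geomMean k (λ j → arrivalValue p f s (j ∸ 1))

selfishValue : List Seat → ℚ
selfishValue s = fromℕ (occupied s) + selfishFill (accessibleEmpty s)

selfishValue-exhausted : ∀ s → accessibleEmpty s ℕ.≤ 0 → selfishValue s ≡ fromℕ (occupied s)
selfishValue-exhausted s a≤0 =
  trans (cong (λ a → fromℕ (occupied s) + selfishFill a) (ℕ.n≤0⇒n≡0 a≤0))
        (+-identityʳ (fromℕ (occupied s)))

selfishValue-place : ∀ {t} → t ≢ empty → ∀ i s → i ℕ.< accessibleEmpty s →
                     selfishValue (place i t s)
                       ≡ fromℕ (occupied s) + 1ℚ + selfishFill (accessibleEmpty (place i t s))
selfishValue-place {t} t≢e i s i<a = cong (_+ selfishFill (accessibleEmpty (place i t s)))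
  (trans (cong fromℕ (occupied-place t≢e i s i<a)) (fromℕ-suc (occupied s)))

arrivalMean-selfishValue : ∀ p s {m} → accessibleEmpty s ≡ suc m →
                           arrivalMean p selfishValue s (suc m)
                             ≡ fromℕ (occupied s) + selfishFill (suc m) + p * courtesyGain m
arrivalMean-selfishValue p s {m} eq = begin
  arrivalMean p selfishValue s (suc m)
    ≡⟨ geomMean-cong (suc m) arrivalValue-selfishValue ⟩
  geomMean (suc m) (λ j → a + q * selfishFill (j ∸ 1))
    ≡⟨ geomMean-affine m a q (λ j → selfishFill (j ∸ 1)) ⟩
  a + q * geomMean (suc m) (λ j → selfishFill (j ∸ 1))
    ≡⟨ cong (λ x → a + q * x) (selfishFill-mean m) ⟩
  a + q * (selfishFill (suc m) - 1ℚ)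
    ≡⟨ solve 4 (λ p o g g′ → o :+ con 1ℚ :+ p :* g :+ (con 1ℚ :- p) :* (g′ :- con 1ℚ)
                           := o :+ g′ :+ p :* (con 1ℚ :+ g :- g′))
             refl p o (selfishFill m) (selfishFill (suc m)) ⟩
  o + selfishFill (suc m) + p * courtesyGain m ∎
  where
  open ≡-Reasoning
  open ℚ-Solver.+-*-Solver
  o = fromℕ (occupied s)
  q = 1ℚ - p
  a = o + 1ℚ + p * selfishFill m
  arrivalValue-selfishValue : ∀ i → i ℕ.< suc m →
                              arrivalValue p selfishValue s i ≡ a + q * selfishFill i
  arrivalValue-selfishValue i i<k = begin
    p * selfishValue (place i courteous s) + q * selfishValue (place i selfish s)
      ≡⟨ cong₂ (λ x y → p * x + q * y) courteous-arrival selfish-arrival ⟩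
    p * (o + 1ℚ + selfishFill m) + q * (o + 1ℚ + selfishFill i)
      ≡⟨ solve 4 (λ p o g gᵢ → p :* (o :+ con 1ℚ :+ g) :+ (con 1ℚ :- p) :* (o :+ con 1ℚ :+ gᵢ)
                             := o :+ con 1ℚ :+ p :* g :+ (con 1ℚ :- p) :* gᵢ)
               refl p o (selfishFill m) (selfishFill i) ⟩
    a + q * selfishFill i ∎
    where
    i<a = subst (i ℕ.<_) (sym eq) i<k
    courteous-arrival : selfishValue (place i courteous s) ≡ o + 1ℚ + selfishFill m
    courteous-arrival = trans (selfishValue-place (λ ()) i s i<a)
      (cong (λ k → o + 1ℚ + selfishFill k)
            (ℕ.suc-injective (trans (accessibleEmpty-place-courteous i s i<a) eq)))
    selfish-arrival : selfishValue (place i selfish s) ≡ o + 1ℚ + selfishFill i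
    selfish-arrival = trans (selfishValue-place (λ ()) i s i<a)
      (cong (λ k → o + 1ℚ + selfishFill k) (accessibleEmpty-place-selfish i s i<a))

module _ {p : ℚ} (0≤p : 0ℚ ≤ p) (p≤1 : p ≤ 1ℚ) where
  private instance
    p-nonNeg : NonNegative p
    p-nonNeg = nonNegative 0≤p
    1-p-nonNeg : NonNegative (1ℚ - p)
    1-p-nonNeg = nonNegative (+-monoʳ-≤ 1ℚ (neg-antimono-≤ p≤1))

  selfishValue-≤-expectedFinal : ∀ fuel s → accessibleEmpty s ℕ.≤ fuel →
                                 selfishValue s ≤ expectedFinal fuel p s
  selfishValue-≤-expectedFinal zero s a≤0 = ≤-reflexive (selfishValue-exhausted s a≤0)
  selfishValue-≤-expectedFinal (suc fuel) s a≤fuel with accessibleEmpty s in eq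
  ... | zero = ≤-reflexive (+-identityʳ (fromℕ (occupied s)))
  selfishValue-≤-expectedFinal (suc fuel) s (s≤s m≤fuel) | suc m = begin
    v                                              ≡⟨ +-identityʳ v ⟨
    v + 0ℚ                                         ≡⟨ cong (λ x → v + x) (*-zeroʳ p) ⟨
    v + p * 0ℚ                                     ≤⟨ +-monoʳ-≤ v drift-nonNeg ⟩
    v + p * courtesyGain m                         ≡⟨ arrivalMean-selfishValue p s eq ⟨
    arrivalMean p selfishValue s (suc m)           ≤⟨ geomMean-mono (suc m) arrivalValue-mono ⟩
    arrivalMean p (expectedFinal fuel p) s (suc m) ∎
    where
    open ≤-Reasoning
    v = fromℕ (occupied s) + selfishFill (suc m)
    drift-nonNeg : p * 0ℚ ≤ p * courtesyGain m
    drift-nonNeg = *-monoˡ-≤-nonNeg p (courtesyGain-nonNeg m)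
    afterArrival : ∀ {t} → t ≢ empty → ∀ i → i ℕ.< suc m →
                   selfishValue (place i t s) ≤ expectedFinal fuel p (place i t s)
    afterArrival {t} t≢e i i<k = selfishValue-≤-expectedFinal fuel (place i t s)
      (ℕ.≤-trans (accessibleEmpty-place-≤ t≢e i s eq i<k) m≤fuel)
    arrivalValue-mono : ∀ i → i ℕ.< suc m →
                        arrivalValue p selfishValue s i ≤ arrivalValue p (expectedFinal fuel p) s i
    arrivalValue-mono i i<k = +-mono-≤ (*-monoˡ-≤-nonNeg p (afterArrival (λ ()) i i<k))
                                       (*-monoˡ-≤-nonNeg (1ℚ - p) (afterArrival (λ ()) i i<k))

expectedFinal-selfish : ∀ fuel s → accessibleEmpty s ℕ.≤ fuel →
                        expectedFinal fuel 0ℚ s ≡ selfishValue s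
expectedFinal-selfish zero s a≤0 = sym (selfishValue-exhausted s a≤0)
expectedFinal-selfish (suc fuel) s a≤fuel with accessibleEmpty s in eq
... | zero = sym (+-identityʳ (fromℕ (occupied s)))
expectedFinal-selfish (suc fuel) s (s≤s m≤fuel) | suc m = begin
  arrivalMean 0ℚ (expectedFinal fuel 0ℚ) s (suc m) ≡⟨ geomMean-cong (suc m) arrivalValue-cong ⟩
  arrivalMean 0ℚ selfishValue s (suc m)            ≡⟨ arrivalMean-selfishValue 0ℚ s eq ⟩
  v + 0ℚ * courtesyGain m                          ≡⟨ cong (λ x → v + x) (*-zeroˡ (courtesyGain m)) ⟩
  v + 0ℚ                                           ≡⟨ +-identityʳ v ⟩
  v                                                ∎
  where
  open ≡-Reasoning
  v = fromℕ (occupied s) + selfishFill (suc m)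
  afterArrival : ∀ {t} → t ≢ empty → ∀ i → i ℕ.< suc m →
                 expectedFinal fuel 0ℚ (place i t s) ≡ selfishValue (place i t s)
  afterArrival {t} t≢e i i<k = expectedFinal-selfish fuel (place i t s)
    (ℕ.≤-trans (accessibleEmpty-place-≤ t≢e i s eq i<k) m≤fuel)
  arrivalValue-cong : ∀ i → i ℕ.< suc m →
                      arrivalValue 0ℚ (expectedFinal fuel 0ℚ) s i ≡ arrivalValue 0ℚ selfishValue s i
  arrivalValue-cong i i<k =
    cong₂ (λ x y → 0ℚ * x + 1ℚ * y) (afterArrival (λ ()) i i<k) (afterArrival (λ ()) i i<k)

occupied-emptyRow : ∀ n → occupied (replicate n empty) ≡ 0
occupied-emptyRow zero    = refl
occupied-emptyRow (suc n) = occupied-emptyRow n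

accessibleEmpty-emptyRow : ∀ n → accessibleEmpty (replicate n empty) ≡ n
accessibleEmpty-emptyRow zero    = refl
accessibleEmpty-emptyRow (suc n) = cong suc (accessibleEmpty-emptyRow n)

selfishValue-emptyRow : ∀ {n} → n ≥ 1 → selfishValue (replicate n empty) ≡ + suc n / 2
selfishValue-emptyRow {suc n} _ rewrite occupied-emptyRow n | accessibleEmpty-emptyRow n =
  +-identityˡ (+ suc (suc n) / 2)

theorem6 : ((p : ℚ) → 0ℚ ≤ p → p ≤ 1ℚ → (n : ℕ) → n ≥ 1 →
                + (suc n) / 2 ≤ expectedOccupied p n)
             × ((n : ℕ) → n ≥ 1 → expectedOccupied 0ℚ n ≡ + (suc n) / 2)
theorem6 = lowerBound , attainedWhenSelfish
  where
  enoughFuel : ∀ n → accessibleEmpty (replicate n empty) ℕ.≤ n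
  enoughFuel n = ℕ.≤-reflexive (accessibleEmpty-emptyRow n)
  lowerBound : ∀ p → 0ℚ ≤ p → p ≤ 1ℚ → ∀ n → n ≥ 1 → + (suc n) / 2 ≤ expectedOccupied p n
  lowerBound p 0≤p p≤1 n n≥1 = subst (_≤ expectedOccupied p n) (selfishValue-emptyRow n≥1)
    (selfishValue-≤-expectedFinal 0≤p p≤1 n (replicate n empty) (enoughFuel n))
  attainedWhenSelfish : ∀ n → n ≥ 1 → expectedOccupied 0ℚ n ≡ + (suc n) / 2
  attainedWhenSelfish n n≥1 =
    trans (expectedFinal-selfish n (replicate n empty) (enoughFuel n)) (selfishValue-emptyRow n≥1)
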